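{- For every $x\in(0,1/2)$, the degree distribution of the Haros graph $G_x$ satisfies $$P(2,x)=x,\qquad P(3,x)=1-2x,\qquad P(4,x)=0.$$
   Context: Farey binary tree: level $\ell_1=\{0/1,1/1\}$, and $\ell_{n+1}$ consists of the mediants $\frac{p+p'}{q+q'}$ of all pairs $p/q<p'/q'$ that are adjacent (in increasing order) in $\bigcup_{i\le n}\ell_i$. Every reduced fraction $p/q\in[0,1]$ occurs exactly once. Every $p/q\in(0,1)$ is the mediant of a unique such adjacent pair $p_1/q_1<p_2/q_2$ (its left and right parents, $p=p_1+p_2$, $q=q_1+q_2$). Symbolic path: by convention paths start at $1/1$ and the step $1/1\to1/2$ is $L$; a node at level $n\ge2$ has two children at level $n+1$, $L$ leading to the smaller and $R$ to the larger. If $x=[a_1,a_2,\dots]$ (i.e. $x=1/(a_1+1/(a_2+\cdots))$), the path of $x$ is $L^{a_1}R^{a_2}L^{a_3}\cdots$, where for rational $x=[a_1,\dots,a_m]$ ($a_m\ge2$) the last exponent is $a_m-1$; irrational $x$ have infinite paths. Haros graphs: graphs with linearly ordered nodes. $G_0$ has two nodes joined by an edge. For $G$ with nodes $v_1,\dots,v_a$ and $G'$ with nodes $w_1,\dots,w_b$, the concatenation $G\oplus G'$ has nodes $u_1,\dots,u_{a+b-1}$, obtained by identifying $v_a$ with $w_1$ (the merging node $u_a$), $u_i=v_i$ for $i\le a$, $u_{a-1+j}=w_j$, keeping all edges of $G$ and $G'$, and adding one new edge $u_1u_{a+b-1}$. Set $G_{0/1}=G_{1/1}=G_0$ and, for reduced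 $p/q\in(0,1)$ with left/right parents $p_1/q_1<p_2/q_2$, $G_{p/q}=G_{p_1/q_1}\oplus G_{p_2/q_2}$; it has $q+1$ nodes. Degree convention: the first and last nodes are identified into a single boundary node whose degree is the sum of their degrees (other nodes are inner), giving $q$ nodes; $P(k,p/q)$ is the fraction of these $q$ nodes with degree $k$. For irrational $x$, $P(k,x)=\lim_{j\to\infty}P(k,x_j)$, where $x_j$ are the successive rationals visited by the symbolic path of $x$. -}

module Defs where

open import Data.Nat as ℕ using (ℕ; zero; suc; _+_; _∸_)
open import Data.Integer using (+_)
open import Data.Rational using (ℚ; _/_; 0ℚ; _<_; _-_; ∣_∣)
open import Data.Product using (_×_; _,_; proj₁; proj₂; ∃)
open import Data.List using (List; []; _∷_; _++_; map; length; filter; upTo)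
open import Data.Nat.ListAction using (sum)
open import Relation.Binary.PropositionalEquality using (_≡_)
open import Relation.Nullary using (¬_)
open import Relation.Nullary.Decidable using (does)
open import Data.Bool using (if_then_else_)

record HGraph : Set where
  constructor hg
  field
    size  : ℕ
    edges : List (ℕ × ℕ)
open HGraph public

G₀ : HGraph
G₀ = hg 2 ((0 , 1) ∷ [])

-- concatenation G ⊕ G' : identify last node of G with first node of G',
-- keep all edges, add an edge between the first and the last node.
_⊕_ : HGraph → HGraph → HGraph
hg a E ⊕ hg b E' =
  hg (a + b ∸ 1)
     (E ++ map (λ e → (proj₁ e + (a ∸ 1)) , (proj₂ e + (a ∸ 1))) E'
        ++ ((0 , a + b ∸ 2) ∷ []))

deg : HGraph → ℕ → ℕ
deg G i = sum (map (λ e → (if does (proj₁ e ℕ.≟ i) then 1 else 0)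
                        + (if does (proj₂ e ℕ.≟ i) then 1 else 0)) (edges G))

-- degree sequence with first and last node identified into one boundary
-- node (degree = sum of the two degrees); the other nodes are inner.
degrees : HGraph → List ℕ
degrees G = (deg G 0 + deg G (size G ∸ 1))
          ∷ map (λ i → deg G (suc i)) (upTo (size G ∸ 2))

-- a / d as a rational (d is never 0 in our uses; 0 is returned for d = 0)
frac : ℕ → ℕ → ℚ
frac a zero    = 0ℚ
frac a (suc d) = + a / suc d

P : ℕ → HGraph → ℚ
P k G = frac (length (filter (λ d → d ℕ.≟ k) (degrees G))) (length (degrees G))

data Dir : Set where
  L R : Dir

record FNode : Set where
  constructor fn
  field
    num   : ℕ
    den   : ℕ
    graph : HGraph
open FNode public

mediant : FNode → FNode → FNode
mediant (fn p q G) (fn p' q' G') = fn (p + p') (q + q') (G ⊕ G')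

descend : FNode → FNode → List Dir → FNode
descend l r []      = mediant l r
descend l r (L ∷ w) = descend l (mediant l r) w
descend l r (R ∷ w) = descend (mediant l r) r w

-- Paths start at 1/1 and the first step 1/1 → 1/2 is L.
-- `node w` is the node reached by the full path  L w  (i.e. L followed by w);
-- the node 1/2 = mediant of 0/1 and 1/1 corresponds to w = [].
node : List Dir → FNode
node w = descend (fn 0 1 G₀) (fn 1 1 G₀) w

val : List Dir → ℚ
val w = frac (num (node w)) (den (node w))

Gr : List Dir → HGraph
Gr w = graph (node w)

prefix : (ℕ → Dir) → ℕ → List Dir
prefix s zero    = []
prefix s (suc j) = s 0 ∷ prefix (λ n → s (suc n)) j

-- infinite path is not eventually constant (these are exactly the paths
-- of irrational numbers)
NotEventuallyConstant : (ℕ → Dir) → Set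
NotEventuallyConstant s = ∀ n → ∃ λ m → (n ℕ.≤ m) × ¬ (s m ≡ s n)

TendsToZero : (ℕ → ℚ) → Set
TendsToZero f = ∀ (ε : ℚ) → 0ℚ < ε → ∃ λ N → ∀ j → N ℕ.≤ j → ∣ f j ∣ < ε

-- two rational sequences have the same limit (equality of the real numbers
-- they define): their difference tends to 0
SameLimit : (ℕ → ℚ) → (ℕ → ℚ) → Set
SameLimit f g = TendsToZero (λ j → f j - g j)

-- G ⊕ H keeps the inner nodes of G and of H with their degrees, adds the merging node, of degree
-- (last degree of G) + (first degree of H), and raises the degrees of the two end nodes by one.
-- Below 1/2 every node is the mediant of parents (0/1, r), where the merging node has degree
-- 1 + 2 = 3, or of parents whose merging node has degree ≥ 5. Induction along the path then shows
-- that G_{p/q} has end degrees ≥ 2, exactly p inner nodes of degree 2, q − 2p of degree 3, none of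
-- degree 4, and a boundary node of degree ≥ 5. So the three formulas hold exactly at every rational
-- on a path starting with L. Paths starting with R lead to x ≥ 1/2.

module Submission where

open import Defs
open import Data.Bool using (true; false; if_then_else_; T)
open import Data.Empty using (⊥-elim)
open import Data.Integer as ℤ using (ℤ; +_)
open import Data.Integer.Properties using (pos-+; pos-*; drop‿+<+)
import Data.Integer.Properties as ℤ
open import Data.Integer.Tactic.RingSolver using (solve-∀)
open import Data.List using (List; []; _∷_; _++_; map; length; filter; upTo; applyUpTo)
open import Data.List.Properties using (map-++; length-++; filter-++; map-upTo; length-map; length-upTo)
open import Data.List.Relation.Unary.All using (All; []; _∷_)
import Data.List.Relation.Unary.All as All
open import Data.List.Relation.Unary.All.Properties using (++⁺; map⁺)
open import Data.Nat as ℕ using (ℕ; zero; suc; _+_; _∸_; _≤_; z≤n; s≤s; z<s; s<s)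
open import Data.Nat.ListAction using (sum)
open import Data.Nat.ListAction.Properties using (sum-++)
open import Data.Nat.Properties
open import Algebra.Properties.CommutativeSemigroup +-commutativeSemigroup using () renaming (interchange to +-interchange)
open import Data.Product using (_×_; _,_; proj₁; proj₂)
open import Data.Rational using (ℚ; _/_; 0ℚ; 1ℚ; ½; _<_; _-_; _*_; -_; toℚᵘ; ∣_∣)
open import Data.Rational.Properties
  using (toℚᵘ-injective; toℚᵘ-fromℚᵘ; toℚᵘ-homo-+; toℚᵘ-homo‿-; toℚᵘ-homo-*; toℚᵘ-mono-<; 0/n≡0)
import Data.Rational.Properties as ℚ
open import Data.Rational.Unnormalised as ℚᵘ using (mkℚᵘ; *≡*; *<*)
import Data.Rational.Unnormalised.Properties as ℚᵘ
open import Function using (_∘_)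
open import Relation.Binary.PropositionalEquality
open import Relation.Nullary using (¬_; does; yes; no)
open import Relation.Nullary.Decidable using (dec-true; dec-false)

δ : ℕ → ℕ → ℕ
δ x i = if does (x ℕ.≟ i) then 1 else 0

δ-refl : ∀ x → δ x x ≡ 1
δ-refl x rewrite dec-true (x ℕ.≟ x) refl = refl

δ-≢ : ∀ {x i} → x ≢ i → δ x i ≡ 0
δ-≢ {x} {i} x≢i rewrite dec-false (x ℕ.≟ i) x≢i = refl

δ-+-below : ∀ x {i k} → i ℕ.< k → δ (x + k) i ≡ 0
δ-+-below x {i} {k} i<k = δ-≢ λ x+k≡i → <⇒≱ i<k (≤-trans (m≤n+m k x) (≤-reflexive x+k≡i))

δ-+ : ∀ x i k → δ (x + k) (i + k) ≡ δ x i
δ-+ x i k with x ℕ.≟ i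
... | yes refl = trans (δ-refl (x + k)) (sym (δ-refl x))
... | no x≢i   = trans (δ-≢ (x≢i ∘ +-cancelʳ-≡ k x i)) (sym (δ-≢ x≢i))

degree : List (ℕ × ℕ) → ℕ → ℕ
degree E i = sum (map (λ e → δ (proj₁ e) i + δ (proj₂ e) i) E)

degree-++ : ∀ E F i → degree (E ++ F) i ≡ degree E i + degree F i
degree-++ E F i = trans (cong sum (map-++ _ E F)) (sum-++ (map _ E) (map _ F))

shift : ℕ → ℕ × ℕ → ℕ × ℕ
shift k e = proj₁ e + k , proj₂ e + k

degree-shift-below : ∀ E {i k} → i ℕ.< k → degree (map (shift k) E) i ≡ 0
degree-shift-below [] i<k = refl
degree-shift-below ((x , y) ∷ E) i<k
  rewrite δ-+-below x i<k | δ-+-below y i<k = degree-shift-below E i<k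

degree-shift : ∀ E i k → degree (map (shift k) E) (i + k) ≡ degree E i
degree-shift [] i k = refl
degree-shift ((x , y) ∷ E) i k rewrite δ-+ x i k | δ-+ y i k | degree-shift E i k = refl

EdgesBelow : ℕ → List (ℕ × ℕ) → Set
EdgesBelow s = All (λ e → proj₁ e ℕ.< s × proj₂ e ℕ.< s)

degree-beyond : ∀ {s E i} → EdgesBelow s E → s ≤ i → degree E i ≡ 0
degree-beyond [] s≤i = refl
degree-beyond ((x<s , y<s) ∷ below) s≤i
  rewrite δ-≢ (<⇒≢ (<-≤-trans x<s s≤i)) | δ-≢ (<⇒≢ (<-≤-trans y<s s≤i)) = degree-beyond below s≤i

EdgesBelow-mono : ∀ {s t E} → s ≤ t → EdgesBelow s E → EdgesBelow t E
EdgesBelow-mono s≤t = All.map λ (x<s , y<s) → <-≤-trans x<s s≤t , <-≤-trans y<s s≤t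

EdgesBelow-shift : ∀ {s E} k → EdgesBelow s E → EdgesBelow (s + k) (map (shift k) E)
EdgesBelow-shift k below = map⁺ (All.map (λ (x<s , y<s) → +-monoˡ-< k x<s , +-monoˡ-< k y<s) below)

count : ℕ → List ℕ → ℕ
count k xs = length (filter (λ d → d ℕ.≟ k) xs)

count-∷ : ∀ k x xs → count k (x ∷ xs) ≡ δ x k + count k xs
count-∷ k x xs with does (x ℕ.≟ k)
... | true  = refl
... | false = refl

count-++ : ∀ k xs ys → count k (xs ++ ys) ≡ count k xs + count k ys
count-++ k xs ys = trans (cong length (filter-++ (λ d → d ℕ.≟ k) xs ys)) (length-++ (filter _ xs))

applyUpTo-++ : ∀ {A : Set} (f : ℕ → A) m n → applyUpTo f (m + n) ≡ applyUpTo f m ++ applyUpTo (λ k → f (m + k)) n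
applyUpTo-++ f zero    n = refl
applyUpTo-++ f (suc m) n = cong (f 0 ∷_) (applyUpTo-++ (f ∘ suc) m n)

applyUpTo-cong : ∀ {A : Set} {f g : ℕ → A} n → (∀ {i} → i ℕ.< n → f i ≡ g i) → applyUpTo f n ≡ applyUpTo g n
applyUpTo-cong zero    f≗g = refl
applyUpTo-cong (suc n) f≗g = cong₂ _∷_ (f≗g z<s) (applyUpTo-cong n (f≗g ∘ s<s))

inner : HGraph → List ℕ
inner G = applyUpTo (deg G ∘ suc) (size G ∸ 2)

boundary : HGraph → ℕ
boundary G = deg G 0 + deg G (size G ∸ 1)

degrees≡boundary∷inner : ∀ G → degrees G ≡ boundary G ∷ inner G
degrees≡boundary∷inner G = cong (boundary G ∷_) (map-upTo (deg G ∘ suc) (size G ∸ 2))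

-- Node i of H becomes node i + (a + 1) of G ⊕ H; node a + 1 is the merging node.
module _ {a b : ℕ} (E F : List (ℕ × ℕ)) where
  private
    G H : HGraph
    G = hg (suc (suc a)) E
    H = hg (suc (suc b)) F

    last≡ : a + suc (suc b) ≡ suc b + suc a
    last≡ = trans (+-comm a (suc (suc b))) (sym (cong suc (+-suc b a)))

  ⊕-deg : ∀ i → deg (G ⊕ H) i ≡ deg G i + (degree (map (shift (suc a)) F) i + (δ 0 i + δ (suc b + suc a) i))
  ⊕-deg i rewrite sym last≡ = begin
    degree (E ++ map (shift (suc a)) F ++ _) i
      ≡⟨ degree-++ E _ i ⟩
    deg G i + degree (map (shift (suc a)) F ++ _) i
      ≡⟨ cong (λ x → deg G i + x) (degree-++ (map (shift (suc a)) F) _ i) ⟩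
    deg G i + (degree (map (shift (suc a)) F) i + (δ 0 i + δ (a + suc (suc b)) i + 0))
      ≡⟨ cong (λ x → deg G i + (degree (map (shift (suc a)) F) i + x)) (+-identityʳ _) ⟩
    deg G i + (degree (map (shift (suc a)) F) i + (δ 0 i + δ (a + suc (suc b)) i)) ∎
    where open ≡-Reasoning

  ⊕-deg-left : ∀ {i} → i ≤ a → deg (G ⊕ H) i ≡ deg G i + δ 0 i
  ⊕-deg-left {i} i≤a
    rewrite ⊕-deg i | degree-shift-below F {k = suc a} (s≤s i≤a)
          | δ-≢ {suc b + suc a} {i} (>⇒≢ (≤-trans (s≤s i≤a) (m≤n+m (suc a) (suc b))))
          = cong (λ x → deg G i + x) (+-identityʳ (δ 0 i))

  ⊕-deg-right : ∀ i → deg (G ⊕ H) (suc (a + i)) ≡ degree E (i + suc a) + (deg H i + δ (suc b) i)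
  ⊕-deg-right i = begin
    deg (G ⊕ H) (suc (a + i))
      ≡⟨ cong (deg (G ⊕ H)) (trans (cong suc (+-comm a i)) (sym (+-suc i a))) ⟩
    deg (G ⊕ H) (i + suc a)
      ≡⟨ ⊕-deg (i + suc a) ⟩
    degree E (i + suc a) + (degree (map (shift (suc a)) F) (i + suc a) + (δ 0 (i + suc a) + δ (suc b + suc a) (i + suc a)))
      ≡⟨ cong (λ x → degree E (i + suc a) + x) (cong₂ _+_ (degree-shift F i (suc a))
           (cong₂ _+_ (δ-≢ (≢-sym (m+1+n≢0 i))) (δ-+ (suc b) i (suc a)))) ⟩
    degree E (i + suc a) + (deg H i + δ (suc b) i) ∎
    where open ≡-Reasoning

  module _ (E-below : EdgesBelow (suc (suc a)) E) where
    private
      E-beyond : ∀ i → degree E (suc i + suc a) ≡ 0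
      E-beyond i = degree-beyond E-below (s≤s (m≤n+m (suc a) i))

    ⊕-deg-last : deg (G ⊕ H) (size (G ⊕ H) ∸ 1) ≡ deg H (suc b) + 1
    ⊕-deg-last = begin
      deg (G ⊕ H) (a + suc (suc b))                      ≡⟨ cong (deg (G ⊕ H)) (+-suc a (suc b)) ⟩
      deg (G ⊕ H) (suc (a + suc b))                      ≡⟨ ⊕-deg-right (suc b) ⟩
      degree E (suc b + suc a) + (deg H (suc b) + δ (suc b) (suc b))
        ≡⟨ cong₂ (λ x y → x + (deg H (suc b) + y)) (E-beyond b) (δ-refl (suc b)) ⟩
      deg H (suc b) + 1 ∎
      where open ≡-Reasoning

    ⊕-inner : inner (G ⊕ H) ≡ inner G ++ (deg G (suc a) + deg H 0) ∷ inner H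
    ⊕-inner = begin
      applyUpTo (deg (G ⊕ H) ∘ suc) (a + suc (suc b) ∸ 1)
        ≡⟨ cong (λ n → applyUpTo (deg (G ⊕ H) ∘ suc) (n ∸ 1)) (+-suc a (suc b)) ⟩
      applyUpTo (deg (G ⊕ H) ∘ suc) (a + suc b)
        ≡⟨ applyUpTo-++ (deg (G ⊕ H) ∘ suc) a (suc b) ⟩
      applyUpTo (deg (G ⊕ H) ∘ suc) a ++ applyUpTo (λ i → deg (G ⊕ H) (suc (a + i))) (suc b)
        ≡⟨ cong₂ _++_ (applyUpTo-cong a λ i<a → trans (⊕-deg-left i<a) (+-identityʳ _))
                      (cong₂ _∷_ merge (applyUpTo-cong b right-inner)) ⟩
      inner G ++ (deg G (suc a) + deg H 0) ∷ inner H ∎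
      where
      open ≡-Reasoning
      merge : deg (G ⊕ H) (suc (a + 0)) ≡ deg G (suc a) + deg H 0
      merge = trans (⊕-deg-right 0) (cong (λ x → deg G (suc a) + x) (+-identityʳ (deg H 0)))
      right-inner : ∀ {i} → i ℕ.< b → deg (G ⊕ H) (suc (a + suc i)) ≡ deg H (suc i)
      right-inner {i} i<b rewrite ⊕-deg-right (suc i) | E-beyond i | δ-≢ (≢-sym (<⇒≢ (s<s i<b))) = +-identityʳ _

    ⊕-edgesBelow : EdgesBelow (suc (suc b)) F → EdgesBelow (suc (suc (a + suc b))) (edges (G ⊕ H))
    ⊕-edgesBelow F-below =
      ++⁺ (EdgesBelow-mono (s≤s (s≤s (m≤m+n a (suc b)))) E-below)
          (++⁺ (EdgesBelow-mono (≤-reflexive (cong (suc ∘ suc) (trans (+-comm b (suc a)) (sym (+-suc a b)))))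
                                (EdgesBelow-shift (suc a) F-below))
               ((z<s , s≤s (≤-reflexive (+-suc a (suc b)))) ∷ []))

    ⊕-count-inner : ∀ k → count k (inner (G ⊕ H))
                        ≡ count k (inner G) + (δ (deg G (suc a) + deg H 0) k + count k (inner H))
    ⊕-count-inner k rewrite ⊕-inner | count-++ k (inner G) ((deg G (suc a) + deg H 0) ∷ inner H) =
      cong (λ x → count k (inner G) + x) (count-∷ k (deg G (suc a) + deg H 0) (inner H))

record WellFormed (v : FNode) : Set where
  constructor wellFormed
  field
    q-1        : ℕ
    size≡      : size (graph v) ≡ suc (suc q-1)
    den≡       : den v ≡ suc q-1
    edgesBelow : EdgesBelow (suc (suc q-1)) (edges (graph v))

firstDeg lastDeg : FNode → ℕ
firstDeg v = deg (graph v) 0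
lastDeg  v = deg (graph v) (size (graph v) ∸ 1)

innerCount : ℕ → FNode → ℕ
innerCount k v = count k (inner (graph v))

mediant-wellFormed : ∀ {l r} → WellFormed l → WellFormed r → WellFormed (mediant l r)
mediant-wellFormed {fn _ _ (hg _ E)} {fn _ _ (hg _ F)} (wellFormed a refl refl E-below) (wellFormed b refl refl F-below) =
  wellFormed (a + suc b) (cong suc (+-suc a (suc b))) refl (⊕-edgesBelow E F E-below F-below)

mediant-firstDeg : ∀ {l r} → WellFormed l → WellFormed r → firstDeg (mediant l r) ≡ firstDeg l + 1
mediant-firstDeg {fn _ _ (hg _ E)} {fn _ _ (hg _ F)} (wellFormed _ refl refl _) (wellFormed _ refl refl _) =
  ⊕-deg-left E F z≤n

mediant-lastDeg : ∀ {l r} → WellFormed l → WellFormed r → lastDeg (mediant l r) ≡ lastDeg r + 1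
mediant-lastDeg {fn _ _ (hg _ E)} {fn _ _ (hg _ F)} (wellFormed _ refl refl E-below) (wellFormed _ refl refl _) =
  ⊕-deg-last E F E-below

mediant-innerCount : ∀ {l r} → WellFormed l → WellFormed r → ∀ k →
  innerCount k (mediant l r) ≡ innerCount k l + (δ (lastDeg l + firstDeg r) k + innerCount k r)
mediant-innerCount {fn _ _ (hg _ E)} {fn _ _ (hg _ F)} (wellFormed _ refl refl E-below) (wellFormed _ refl refl _) =
  ⊕-count-inner E F E-below

0/1 1/1 : FNode
0/1 = fn 0 1 G₀
1/1 = fn 1 1 G₀

0/1-wellFormed : WellFormed 0/1
0/1-wellFormed = wellFormed 0 refl refl ((z<s , s<s z<s) ∷ [])

record DegreeLaw (v : FNode) : Set where
  field
    wf         : WellFormed v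
    firstDeg≥2 : 2 ≤ firstDeg v
    lastDeg≥2  : 2 ≤ lastDeg v
    count₂     : innerCount 2 v ≡ num v
    count₃     : innerCount 3 v + (num v + num v) ≡ den v
    count₄     : innerCount 4 v ≡ 0
open DegreeLaw

data Parents : FNode → FNode → Set where
  leftmost : ∀ {r} → DegreeLaw r → firstDeg r ≡ 2 → Parents 0/1 r
  heavy    : ∀ {l r} → DegreeLaw l → DegreeLaw r → 5 ≤ lastDeg l + firstDeg r → Parents l r

Parents-wellFormedˡ : ∀ {l r} → Parents l r → WellFormed l
Parents-wellFormedˡ (leftmost _ _)  = 0/1-wellFormed
Parents-wellFormedˡ (heavy law _ _) = wf law

Parents-lawʳ : ∀ {l r} → Parents l r → DegreeLaw r
Parents-lawʳ (leftmost law _) = law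
Parents-lawʳ (heavy _ law _)  = law

mediant-lastDeg≥3 : ∀ {l r} → Parents l r → 3 ≤ lastDeg (mediant l r)
mediant-lastDeg≥3 parents = subst (3 ≤_) (sym (mediant-lastDeg (Parents-wellFormedˡ parents) (wf lawʳ)))
                                  (+-monoˡ-≤ 1 (lastDeg≥2 lawʳ))
  where lawʳ = Parents-lawʳ parents

mediant-law : ∀ {l r} → Parents l r → DegreeLaw (mediant l r)
mediant-law parents@(leftmost {r} law first≡2) = record
  { wf         = mediant-wellFormed 0/1-wellFormed (wf law)
  ; firstDeg≥2 = ≤-reflexive (sym (mediant-firstDeg 0/1-wellFormed (wf law)))
  ; lastDeg≥2  = ≤-trans (n≤1+n 2) (mediant-lastDeg≥3 parents)
  ; count₂     = trans (counts 2) (count₂ law)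
  ; count₃     = trans (cong (_+ (num r + num r)) (counts 3)) (cong suc (count₃ law))
  ; count₄     = trans (counts 4) (count₄ law)
  }
  where
  counts : ∀ k → innerCount k (mediant 0/1 r) ≡ δ 3 k + innerCount k r
  counts k = trans (mediant-innerCount 0/1-wellFormed (wf law) k)
                   (cong (λ d → δ (1 + d) k + innerCount k r) first≡2)
mediant-law parents@(heavy {l} {r} lawˡ lawʳ merge≥5) = record
  { wf         = mediant-wellFormed (wf lawˡ) (wf lawʳ)
  ; firstDeg≥2 = subst (2 ≤_) (sym (mediant-firstDeg (wf lawˡ) (wf lawʳ))) (m≤n⇒m≤n+o 1 (firstDeg≥2 lawˡ))
  ; lastDeg≥2  = ≤-trans (n≤1+n 2) (mediant-lastDeg≥3 parents)
  ; count₂     = trans (counts 2 _) (cong₂ _+_ (count₂ lawˡ) (count₂ lawʳ))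
  ; count₃     = begin
      innerCount 3 (mediant l r) + ((num l + num r) + (num l + num r))
        ≡⟨ cong₂ _+_ (counts 3 _) (+-interchange (num l) (num r) (num l) (num r)) ⟩
      (innerCount 3 l + innerCount 3 r) + ((num l + num l) + (num r + num r))
        ≡⟨ +-interchange (innerCount 3 l) (innerCount 3 r) (num l + num l) (num r + num r) ⟩
      (innerCount 3 l + (num l + num l)) + (innerCount 3 r + (num r + num r))
        ≡⟨ cong₂ _+_ (count₃ lawˡ) (count₃ lawʳ) ⟩
      den l + den r ∎
  ; count₄     = trans (counts 4 _) (cong₂ _+_ (count₄ lawˡ) (count₄ lawʳ))
  }
  where
  open ≡-Reasoning
  -- `T (k ℕ.<ᵇ 5)` states k < 5 in a form that `_` proves for a literal k.
  counts : ∀ k → T (k ℕ.<ᵇ 5) → innerCount k (mediant l r) ≡ innerCount k l + innerCount k r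
  counts k k<5 = trans (mediant-innerCount (wf lawˡ) (wf lawʳ) k)
    (cong (λ x → innerCount k l + (x + innerCount k r)) (δ-≢ (>⇒≢ (<-≤-trans (<ᵇ⇒< k 5 k<5) merge≥5))))

mediant-boundary≥5 : ∀ {l r} → Parents l r → 5 ≤ boundary (graph (mediant l r))
mediant-boundary≥5 parents = +-mono-≤ (firstDeg≥2 (mediant-law parents)) (mediant-lastDeg≥3 parents)

mediant-parentsʳ : ∀ {l r} → Parents l r → Parents (mediant l r) r
mediant-parentsʳ parents = heavy (mediant-law parents) lawʳ (+-mono-≤ (mediant-lastDeg≥3 parents) (firstDeg≥2 lawʳ))
  where lawʳ = Parents-lawʳ parents

mediant-parentsˡ : ∀ {l r} → Parents l r → Parents l (mediant l r)
mediant-parentsˡ parents@(leftmost law _) =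
  leftmost (mediant-law parents) (mediant-firstDeg 0/1-wellFormed (wf law))
mediant-parentsˡ parents@(heavy lawˡ lawʳ _) =
  heavy lawˡ (mediant-law parents)
    (+-mono-≤ (lastDeg≥2 lawˡ)
              (subst (3 ≤_) (sym (mediant-firstDeg (wf lawˡ) (wf lawʳ))) (+-monoˡ-≤ 1 (firstDeg≥2 lawˡ))))

descend-law : ∀ {l r} w → Parents l r →
              DegreeLaw (descend l r w) × 5 ≤ boundary (graph (descend l r w))
descend-law []      parents = mediant-law parents , mediant-boundary≥5 parents
descend-law (L ∷ w) parents = descend-law w (mediant-parentsˡ parents)
descend-law (R ∷ w) parents = descend-law w (mediant-parentsʳ parents)

1/2-law : DegreeLaw (mediant 0/1 1/1)
1/2-law = record
  { wf         = mediant-wellFormed 0/1-wellFormed (wellFormed 0 refl refl ((z<s , s<s z<s) ∷ []))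
  ; firstDeg≥2 = ≤-refl
  ; lastDeg≥2  = ≤-refl
  ; count₂     = refl
  ; count₃     = refl
  ; count₄     = refl
  }

node-L-law : ∀ w → DegreeLaw (node (L ∷ w)) × 5 ≤ boundary (Gr (L ∷ w))
node-L-law w = descend-law w (leftmost 1/2-law refl)

P≡innerCount/den : ∀ {v} k → T (k ℕ.<ᵇ 5) → WellFormed v → 5 ≤ boundary (graph v) →
                   P k (graph v) ≡ frac (innerCount k v) (den v)
P≡innerCount/den {v} k k<5 (wellFormed q-1 size≡ den≡ _) boundary≥5 = cong₂ frac count≡ length≡
  where
  G = graph v
  count≡ : count k (degrees G) ≡ innerCount k v
  count≡ = begin
    count k (degrees G)               ≡⟨ cong (count k) (degrees≡boundary∷inner G) ⟩
    count k (boundary G ∷ inner G)    ≡⟨ count-∷ k (boundary G) (inner G) ⟩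
    δ (boundary G) k + innerCount k v ≡⟨ cong (_+ innerCount k v) (δ-≢ boundary≢k) ⟩
    innerCount k v                    ∎
    where
    open ≡-Reasoning
    boundary≢k = >⇒≢ (<-≤-trans (<ᵇ⇒< k 5 k<5) boundary≥5)
  length≡ : length (degrees G) ≡ den v
  length≡ = begin
    suc (length (map (deg G ∘ suc) (upTo m)))  ≡⟨ cong suc (length-map (deg G ∘ suc) (upTo m)) ⟩
    suc (length (upTo m))                     ≡⟨ cong suc (length-upTo m) ⟩
    suc (size G ∸ 2)                          ≡⟨ cong (λ s → suc (s ∸ 2)) size≡ ⟩
    suc q-1                                   ≡⟨ sym den≡ ⟩
    den v                                     ∎
    where
    open ≡-Reasoning
    m = size G ∸ 2

-- In ℚᵘ the denominators d′ and d″ of 1 − 2 · (p / d) are d only up to `n + 0`.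
cross-multiplied : ∀ {c p d d′ d″ : ℤ} → d′ ≡ d → d″ ≡ d → c ℤ.+ (p ℤ.+ p) ≡ d →
                   c ℤ.* d′ ≡ (+ 1 ℤ.* d″ ℤ.+ ℤ.- (+ 2 ℤ.* p) ℤ.* + 1) ℤ.* d
cross-multiplied {c} {p} refl refl refl = identity c p
  where
  identity : ∀ c p → c ℤ.* (c ℤ.+ (p ℤ.+ p))
                   ≡ (+ 1 ℤ.* (c ℤ.+ (p ℤ.+ p)) ℤ.+ ℤ.- (+ 2 ℤ.* p) ℤ.* + 1) ℤ.* (c ℤ.+ (p ℤ.+ p))
  identity = solve-∀

frac-complementᵘ : ∀ c p n → c + (p + p) ≡ suc n →
                   mkℚᵘ (+ c) n ℚᵘ.≃ mkℚᵘ (+ 1) 0 ℚᵘ.- mkℚᵘ (+ 2) 0 ℚᵘ.* mkℚᵘ (+ p) n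
frac-complementᵘ c p n c+2p≡d = *≡* (cross-multiplied {+ c} {+ p}
  (cong (+_ ∘ suc) (trans (+-identityʳ _) (+-identityʳ n)))
  (cong (+_ ∘ suc) (+-identityʳ n))
  (trans (sym (trans (pos-+ c (p + p)) (cong (λ z → + c ℤ.+ z) (pos-+ p p)))) (cong +_ c+2p≡d)))

frac-complement : ∀ c p {d} → 1 ≤ d → c + (p + p) ≡ d → frac c d ≡ 1ℚ - (+ 2 / 1) * frac p d
frac-complement c p {suc n} _ c+2p≡d = toℚᵘ-injective (begin
  toℚᵘ (frac c (suc n))             ≈⟨ toℚᵘ-fromℚᵘ (mkℚᵘ (+ c) n) ⟩
  mkℚᵘ (+ c) n                      ≈⟨ frac-complementᵘ c p n c+2p≡d ⟩
  1ᵘ ℚᵘ.- 2ᵘ ℚᵘ.* mkℚᵘ (+ p) n       ≈⟨ ℚᵘ.+-congʳ 1ᵘ (ℚᵘ.-‿cong (ℚᵘ.*-congˡ {2ᵘ} (toℚᵘ-fromℚᵘ (mkℚᵘ (+ p) n)))) ⟨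
  1ᵘ ℚᵘ.- 2ᵘ ℚᵘ.* toℚᵘ x             ≈⟨ homo ⟨
  toℚᵘ (1ℚ - (+ 2 / 1) * x)         ∎)
  where
  open ℚᵘ.≃-Reasoning
  x = frac p (suc n)
  1ᵘ = toℚᵘ 1ℚ
  2ᵘ = toℚᵘ (+ 2 / 1)
  homo : toℚᵘ (1ℚ - (+ 2 / 1) * x) ℚᵘ.≃ 1ᵘ ℚᵘ.- 2ᵘ ℚᵘ.* toℚᵘ x
  homo = ℚᵘ.≃-trans (toℚᵘ-homo-+ 1ℚ (- ((+ 2 / 1) * x)))
           (ℚᵘ.+-congʳ 1ᵘ (ℚᵘ.≃-trans (toℚᵘ-homo‿- ((+ 2 / 1) * x)) (ℚᵘ.-‿cong (toℚᵘ-homo-* (+ 2 / 1) x))))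

frac<½⇒ : ∀ p n → frac p (suc n) < ½ → p + p ℕ.< suc n
frac<½⇒ p n x<½ with ℚᵘ.<-respˡ-≃ (toℚᵘ-fromℚᵘ (mkℚᵘ (+ p) n)) (toℚᵘ-mono-< x<½)
... | *<* 2p<d =
  subst (ℕ._< suc n) 2p≡p+p (drop‿+<+ (subst₂ ℤ._<_ (sym (pos-* p 2)) (ℤ.*-identityˡ (+ suc n)) 2p<d))
  where
  2p≡p+p : p ℕ.* 2 ≡ p + p
  2p≡p+p = trans (*-comm p 2) (cong (λ z → p + z) (+-identityʳ p))

frac-zero : ∀ d → frac 0 d ≡ 0ℚ
frac-zero zero    = refl
frac-zero (suc n) = 0/n≡0 (suc n)

frac≮½ : ∀ p {d} → 1 ≤ d → d ≤ p + p → ¬ frac p d < ½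
frac≮½ p {suc n} _ d≤2p x<½ = <⇒≱ (frac<½⇒ p n x<½) d≤2p

record AtLeastHalf (v : FNode) : Set where
  constructor atLeastHalf
  field
    den≥1     : 1 ≤ den v
    den≤2num  : den v ≤ num v + num v

mediant-atLeastHalf : ∀ {l r} → AtLeastHalf l → AtLeastHalf r → AtLeastHalf (mediant l r)
mediant-atLeastHalf {l} {r} (atLeastHalf 1≤dˡ dˡ≤2pˡ) (atLeastHalf _ dʳ≤2pʳ) = atLeastHalf
  (≤-trans 1≤dˡ (m≤m+n (den l) (den r)))
  (≤-trans (+-mono-≤ dˡ≤2pˡ dʳ≤2pʳ) (≤-reflexive (+-interchange (num l) (num l) (num r) (num r))))

descend-atLeastHalf : ∀ {l r} w → AtLeastHalf l → AtLeastHalf r → AtLeastHalf (descend l r w)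
descend-atLeastHalf []      hˡ hʳ = mediant-atLeastHalf hˡ hʳ
descend-atLeastHalf (L ∷ w) hˡ hʳ = descend-atLeastHalf w hˡ (mediant-atLeastHalf hˡ hʳ)
descend-atLeastHalf (R ∷ w) hˡ hʳ = descend-atLeastHalf w (mediant-atLeastHalf hˡ hʳ) hʳ

val-R≮½ : ∀ w → ¬ val (R ∷ w) < ½
val-R≮½ w with descend-atLeastHalf w (atLeastHalf (s≤s z≤n) (s≤s (s≤s z≤n))) (atLeastHalf (s≤s z≤n) (s≤s z≤n))
... | atLeastHalf 1≤d d≤2p = frac≮½ _ 1≤d d≤2p

HarosLaw : List Dir → Set
HarosLaw w = (P 2 (Gr w) ≡ val w) × (P 3 (Gr w) ≡ 1ℚ - (+ 2 / 1) * val w) × (P 4 (Gr w) ≡ 0ℚ)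

harosLaw-L : ∀ w → HarosLaw (L ∷ w)
harosLaw-L w = P₂ , P₃ , P₄
  where
  v = node (L ∷ w)
  law = proj₁ (node-L-law w)
  open WellFormed (wf law) using (den≡)

  P≡ : ∀ k → T (k ℕ.<ᵇ 5) → P k (graph v) ≡ frac (innerCount k v) (den v)
  P≡ k k<5 = P≡innerCount/den k k<5 (wf law) (proj₂ (node-L-law w))

  P₂ = trans (P≡ 2 _) (cong (λ c → frac c (den v)) (count₂ law))
  P₃ = trans (P≡ 3 _) (frac-complement (innerCount 3 v) (num v) (subst (1 ≤_) (sym den≡) (s≤s z≤n)) (count₃ law))
  P₄ = trans (P≡ 4 _) (trans (cong (λ c → frac c (den v)) (count₄ law)) (frac-zero (den v)))

harosLaw : ∀ w → 0ℚ < val w → val w < ½ → HarosLaw w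
harosLaw []      _ x<½ = ⊥-elim (ℚ.<-irrefl refl x<½)
harosLaw (L ∷ w) _ _   = harosLaw-L w
harosLaw (R ∷ w) _ x<½ = ⊥-elim (val-R≮½ w x<½)

SameLimit-eventually-≡ : ∀ (f g : ℕ → ℚ) → (∀ j → f (suc j) ≡ g (suc j)) → SameLimit f g
SameLimit-eventually-≡ f g f≡g ε ε>0 = 1 , λ { (suc j) _ →
  subst (λ x → ∣ x ∣ < ε) (sym (trans (cong (_- g (suc j)) (f≡g j)) (ℚ.+-inverseʳ (g (suc j))))) ε>0 }

harosLaw-prefix : ∀ s → s 0 ≡ L → ∀ j → HarosLaw (prefix s (suc j))
harosLaw-prefix s s₀≡L j = subst (λ d → HarosLaw (d ∷ prefix (s ∘ suc) j)) (sym s₀≡L) (harosLaw-L (prefix (s ∘ suc) j))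

theorem1 :
  -- rational x = p/q ∈ (0,1/2), given by its symbolic path  L w
  ((w : List Dir) → 0ℚ < val w → val w < ½ →
      (P 2 (Gr w) ≡ val w)
    × (P 3 (Gr w) ≡ 1ℚ - (+ 2 / 1) * val w)
    × (P 4 (Gr w) ≡ 0ℚ))
  ×
  -- irrational x ∈ (0,1/2), given by its infinite path  L s  (s 0 = L),
  -- with x_j the rationals visited along the path and x = lim x_j
  ((s : ℕ → Dir) → NotEventuallyConstant s → s 0 ≡ L →
      SameLimit (λ j → P 2 (Gr (prefix s j))) (λ j → val (prefix s j))
    × SameLimit (λ j → P 3 (Gr (prefix s j)))
                (λ j → 1ℚ - (+ 2 / 1) * val (prefix s j))
    × SameLimit (λ j → P 4 (Gr (prefix s j))) (λ j → 0ℚ))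
theorem1 = harosLaw , λ s _ s₀≡L → let law = harosLaw-prefix s s₀≡L in
    SameLimit-eventually-≡ (P 2 ∘ Gr ∘ prefix s) (val ∘ prefix s) (proj₁ ∘ law)
  , SameLimit-eventually-≡ (P 3 ∘ Gr ∘ prefix s) (λ j → 1ℚ - (+ 2 / 1) * val (prefix s j)) (proj₁ ∘ proj₂ ∘ law)
  , SameLimit-eventually-≡ (P 4 ∘ Gr ∘ prefix s) (λ _ → 0ℚ) (proj₂ ∘ proj₂ ∘ law)
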